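{- Let $m,k$ be positive integers. There is a bijection between the set $\mathcal{Q}(m,k)$ and the set $\mathcal{SD}(2m,2k)$.
   Context: For a positive integer $k$ and real $s$, a free ballot $(s,k)$-path of height $n$ is a lattice path from $(0,0)$ to $(s,n)$ with up steps $(k/2,1)$, down steps $(k/2,-1)$ and horizontal steps $(\ell,0)$ ($\ell$ an integer, $1\le\ell<k$), allowed to go below the $x$-axis. $\mathcal{FB}'_n(s,k)$ is the set of such paths whose first step is horizontal or down. $\mathcal{Q}(m,k)=\bigl(\bigcup_{i=0}^{k-2}\mathcal{FB}'_0(m-i,2k)\bigr)\cup\mathcal{FB}'_{ -1}(m+1,2k)$. An $(s,k)$-Dyck path is a free ballot $(s,k)$-path of height $0$ never going below the $x$-axis; it is symmetric if its reflection about the line $x=s/2$ is itself. $\mathcal{SD}(s,k)$ is the set of symmetric $(s,k)$-Dyck paths. -}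

module Defs where

open import Data.Nat as ℕ using (ℕ; suc; _∸_)
open import Data.Integer as ℤ using (ℤ; +_; -[1+_]; _+_; _-_; 0ℤ; 1ℤ; -1ℤ)
open import Data.Fin using (Fin; toℕ)
open import Data.List using (List; []; _∷_; reverse; map)
open import Data.Product using (Σ; _×_)
open import Data.Sum using (_⊎_)
open import Data.Unit using (⊤)
open import Data.Empty using (⊥)
open import Relation.Binary.PropositionalEquality using (_≡_)

-- Steps of a free ballot (s,2k)-path: up (k,1), down (k,-1),
-- horizontal (ℓ,0) with ℓ an integer, 1 ≤ ℓ < 2k.
data Step (k : ℕ) : Set where
  up   : Step k
  down : Step k
  hor  : (ℓ : ℕ) → 1 ℕ.≤ ℓ → ℓ ℕ.< 2 ℕ.* k → Step k

stepWidth : {k : ℕ} → Step k → ℕ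
stepWidth {k} up        = k
stepWidth {k} down      = k
stepWidth     (hor ℓ _ _) = ℓ

width : {k : ℕ} → List (Step k) → ℕ
width []       = 0
width (s ∷ p)  = stepWidth s ℕ.+ width p

stepRise : {k : ℕ} → Step k → ℤ
stepRise up          = 1ℤ
stepRise down        = -1ℤ
stepRise (hor _ _ _) = 0ℤ

rise : {k : ℕ} → List (Step k) → ℤ
rise []      = 0ℤ
rise (s ∷ p) = stepRise s + rise p

FirstNotUp : {k : ℕ} → List (Step k) → Set
FirstNotUp []            = ⊤
FirstNotUp (up ∷ _)      = ⊥
FirstNotUp (down ∷ _)    = ⊤
FirstNotUp (hor _ _ _ ∷ _) = ⊤

FB : (s : ℤ) (k : ℕ) (n : ℤ) → Set
FB s k n = Σ (List (Step k)) λ p → (+ width p ≡ s) × (rise p ≡ n)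

FB' : (s : ℤ) (k : ℕ) (n : ℤ) → Set
FB' s k n = Σ (List (Step k)) λ p → (+ width p ≡ s) × (rise p ≡ n) × FirstNotUp p

-- Q(m,k) = (⋃_{i=0}^{k-2} FB'_0(m-i,2k)) ∪ FB'_{-1}(m+1,2k)
-- (the pieces are pairwise disjoint since their endpoints differ)
Q : (m k : ℕ) → Set
Q m k = (Σ (Fin (k ∸ 1)) λ i → FB' (+ m - + toℕ i) k 0ℤ) ⊎ FB' (+ m + 1ℤ) k -1ℤ

StaysAbove : {k : ℕ} → ℤ → List (Step k) → Set
StaysAbove h []      = ⊤
StaysAbove h (s ∷ p) = (0ℤ ℤ.≤ h + stepRise s) × StaysAbove (h + stepRise s) p

-- reflection about the vertical line x = s/2: reverse order, swap up/down
flipStep : {k : ℕ} → Step k → Step k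
flipStep up            = down
flipStep down          = up
flipStep (hor ℓ p q)   = hor ℓ p q

reflect : {k : ℕ} → List (Step k) → List (Step k)
reflect p = reverse (map flipStep p)

SD : (s : ℕ) (k : ℕ) → Set
SD s k = Σ (List (Step k)) λ p →
  (width p ≡ s) × (rise p ≡ 0ℤ) × StaysAbove 0ℤ p × (reflect p ≡ p)

module Submission where

-- It is the composite of three bijections, each established separately.
--
-- A list is mirror-symmetric iff it has the shape
--     a ++ c ++ mirror a with a centre c that is empty or a single fixed point
--     (module Mirror, for any involution).  For paths the centre is one
--     horizontal step; width 2m forces it to have even width 2j < 2k with
--     width a + j = m, and the Dyck condition says that a is a ballot path.
--  2. Halves m k ↔ LowHalves m k.  The classical bijection between ballot
--     paths and free paths ending at height 0 or -1: raise turns each down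
--     step reaching a new minimum into an up step; lower turns ⌈h/2⌉ up steps
--     back, h being the final height of the ballot path.
--  3. LowHalves m k ↔ Q(m,k).  A pair (j, p) lands in FB'_0(m - j) when p ends
--     at 0 and does not start with an up step; otherwise j and the first step
--     of p are encoded into a first step of a path of FB'_{-1}(m + 1).

open import Defs
open import Data.Nat as ℕ
  using (ℕ; zero; suc; pred; _+_; _*_; _∸_; _≤_; _<_; z≤n; s≤s; ⌊_/2⌋; ⌈_/2⌉)
import Data.Nat.Properties as ℕP
import Data.Nat.Tactic.RingSolver as ℕSolver
open import Data.Integer as ℤ using (ℤ; +_; 0ℤ; 1ℤ; -1ℤ; -_)
import Data.Integer.Properties as ℤP
open import Data.Integer.Tactic.RingSolver using (solve-∀)
open import Algebra.Properties.AbelianGroup ℤP.+-0-abelianGroup using (∙-cancelˡ; ∙-cancelʳ)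
open import Data.List using (List; []; _∷_; _++_; [_]; reverse; map; length; _∷ʳ_; initLast; _∷ʳ′_)
import Data.List.Properties as LP
open import Data.Product using (Σ; _×_; _,_; proj₁; proj₂)
open import Data.Sum as Sum using (_⊎_; inj₁; inj₂)
open import Relation.Binary.Definitions using (tri<; tri≈; tri>)
open import Data.Unit using (⊤; tt)
open import Data.Empty using (⊥; ⊥-elim)
open import Relation.Nullary using (Irrelevant; Dec; yes; no; ¬_; contradiction; _×-dec_)
open import Relation.Binary.PropositionalEquality hiding ([_])
open import Axiom.UniquenessOfIdentityProofs.WithK using (uip)
open import Function using (_∘_; id)
open import Data.Fin using (Fin; toℕ; fromℕ<)
import Data.Fin.Properties as FP
open import Function.Bundles using (_↔_; _⤖_; mk↔ₛ′)
open import Function.Properties.Inverse using (↔⇒⤖; ↔-sym; ↔-trans)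

Σ-≡ : {A : Set} {B : A → Set} → (∀ x → Irrelevant (B x)) →
      {s t : Σ A B} → proj₁ s ≡ proj₁ t → s ≡ t
Σ-≡ irr {x , b} {.x , c} refl = cong (x ,_) (irr x b c)

×-irrelevant : {A B : Set} → Irrelevant A → Irrelevant B → Irrelevant (A × B)
×-irrelevant irrA irrB (a , b) (a' , b') = cong₂ _,_ (irrA a a') (irrB b b')

++-prefix-unique : {A : Set} (xs xs' : List A) {ys ys' : List A} →
                   length xs ≡ length xs' → xs ++ ys ≡ xs' ++ ys' → xs ≡ xs'
++-prefix-unique []       []         _   _ = refl
++-prefix-unique (x ∷ xs) (x' ∷ xs') len e =
  cong₂ _∷_ (LP.∷-injectiveˡ e) (++-prefix-unique xs xs' (ℕP.suc-injective len) (LP.∷-injectiveʳ e))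

excess-< : ∀ {x y e e'} → x < y → e ≤ 1 → x + (e + x) < y + (e' + y)
excess-< {x} {y} {e} {e'} x<y e≤1 =
  ℕP.+-mono-<-≤ x<y (ℕP.≤-trans (ℕP.+-monoˡ-≤ x e≤1) (ℕP.≤-trans x<y (ℕP.m≤n+m y e')))

excess-unique : ∀ x y {e e'} → x + (e + x) ≡ y + (e' + y) → e ≤ 1 → e' ≤ 1 → x ≡ y
excess-unique x y eq e≤1 e'≤1 with ℕP.<-cmp x y
... | tri< x<y _ _ = contradiction eq (ℕP.<⇒≢ (excess-< x<y e≤1))
... | tri≈ _ x≡y _ = x≡y
... | tri> _ _ y<x = contradiction (sym eq) (ℕP.<⇒≢ (excess-< y<x e'≤1))
⌈/2⌉-parity : ∀ h → h ≡ ⌈ h /2⌉ + ⌈ h /2⌉ ⊎ suc h ≡ ⌈ h /2⌉ + ⌈ h /2⌉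
⌈/2⌉-parity zero          = inj₁ refl
⌈/2⌉-parity (suc zero)    = inj₂ refl
⌈/2⌉-parity (suc (suc h)) = Sum.map add-two add-two (⌈/2⌉-parity h)
  where
  c = ⌈ h /2⌉
  add-two : ∀ {n} → n ≡ c + c → suc (suc n) ≡ suc c + suc c
  add-two e = cong suc (trans (cong suc e) (sym (ℕP.+-suc c c)))

⌈/2⌉-unique : ∀ h f → h ≡ f + f ⊎ suc h ≡ f + f → ⌈ h /2⌉ ≡ f
⌈/2⌉-unique _ f (inj₁ refl) = sym (ℕP.n≡⌈n+n/2⌉ f)
⌈/2⌉-unique _ f (inj₂ e)    = trans (cong ⌊_/2⌋ e) (sym (ℕP.n≡⌊n+n/2⌋ f))

low⇒half : ∀ h f r → + h ≡ r ℤ.+ + (f + f) → r ≡ 0ℤ ⊎ r ≡ -1ℤ → ⌈ h /2⌉ ≡ f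
low⇒half h f _ e (inj₁ refl) = ⌈/2⌉-unique h f (inj₁ (ℤP.+-injective e))
low⇒half h f _ e (inj₂ refl) = ⌈/2⌉-unique h f (inj₂ (ℤP.+-injective (trans (cong (ℤ._+_ 1ℤ) e) (cancel _))))
  where
  cancel : ∀ x → 1ℤ ℤ.+ (-1ℤ ℤ.+ x) ≡ x
  cancel = solve-∀

half⇒low : ∀ h r → let c = ⌈ h /2⌉ in + h ≡ r ℤ.+ + (c + c) → r ≡ 0ℤ ⊎ r ≡ -1ℤ
half⇒low h r e with ⌈/2⌉-parity h
... | inj₁ h≡ = inj₁ (∙-cancelʳ _ r 0ℤ (trans (sym e) (cong +_ h≡)))
... | inj₂ h+1≡ = inj₂ (∙-cancelʳ _ r -1ℤ
      (trans (sym e) (trans (sym (cancel (+ h))) (cong (ℤ._+_ -1ℤ) (cong +_ h+1≡)))))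
  where
  cancel : ∀ x → -1ℤ ℤ.+ (1ℤ ℤ.+ x) ≡ x
  cancel = solve-∀

halve : ∀ a c m → a + (c + a) ≡ 2 * m → a ≤ m × c ≡ 2 * (m ∸ a)
halve a c m e = a≤m , c≡
  where
  reorder : ∀ a c → a + (c + a) ≡ 2 * a + c
  reorder = ℕSolver.solve-∀
  2a+c≡2m : 2 * a + c ≡ 2 * m
  2a+c≡2m = trans (sym (reorder a c)) e
  a≤m : a ≤ m
  a≤m = ℕP.*-cancelˡ-≤ 2 (subst (2 * a ≤_) 2a+c≡2m (ℕP.m≤m+n (2 * a) c))
  c≡ : c ≡ 2 * (m ∸ a)
  c≡ = begin
    c                ≡⟨ ℕP.m+n∸m≡n (2 * a) c ⟨
    2 * a + c ∸ 2 * a ≡⟨ cong (_∸ 2 * a) 2a+c≡2m ⟩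
    2 * m ∸ 2 * a    ≡⟨ ℕP.*-distribˡ-∸ 2 m a ⟨
    2 * (m ∸ a)      ∎
    where open ≡-Reasoning

double : ∀ n → 2 * n ≡ n + n
double n = cong (_+_ n) (ℕP.+-identityʳ n)


module Mirror {A : Set} (f : A → A) (f-involutive : ∀ x → f (f x) ≡ x) where

  mirror : List A → List A
  mirror xs = reverse (map f xs)

  mirror-++ : ∀ xs ys → mirror (xs ++ ys) ≡ mirror ys ++ mirror xs
  mirror-++ xs ys = trans (cong reverse (LP.map-++ f xs ys)) (LP.reverse-++ (map f xs) (map f ys))

  mirror-involutive : ∀ xs → mirror (mirror xs) ≡ xs
  mirror-involutive xs = begin
    reverse (map f (reverse (map f xs)))  ≡⟨ cong reverse (LP.reverse-map f (map f xs)) ⟩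
    reverse (reverse (map f (map f xs)))  ≡⟨ LP.reverse-involutive _ ⟩
    map f (map f xs)                      ≡⟨ LP.map-∘ xs ⟨
    map (f ∘ f) xs                        ≡⟨ LP.map-cong f-involutive xs ⟩
    map id xs                             ≡⟨ LP.map-id xs ⟩
    xs                                    ∎
    where open ≡-Reasoning

  length-mirror : ∀ xs → length (mirror xs) ≡ length xs
  length-mirror xs = trans (LP.length-reverse (map f xs)) (LP.length-map f xs)

  data Centre : List A → Set where
    none  : Centre []
    fixed : ∀ {x} → f x ≡ x → Centre [ x ]

  centre-length : ∀ {c} → Centre c → length c ≤ 1
  centre-length none      = z≤n
  centre-length (fixed _) = s≤s z≤n

  mirror-centre : ∀ {c} → Centre c → mirror c ≡ c
  mirror-centre none       = refl
  mirror-centre (fixed fx) = cong [_] fx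

  record Split (xs : List A) : Set where
    constructor split
    field
      half     : List A
      centre   : List A
      isCentre : Centre centre
      shape    : xs ≡ half ++ centre ++ mirror half

  split-symmetric : ∀ a {c} → Centre c → mirror (a ++ c ++ mirror a) ≡ a ++ c ++ mirror a
  split-symmetric a {c} C = begin
    mirror (a ++ c ++ mirror a)                ≡⟨ mirror-++ a (c ++ mirror a) ⟩
    mirror (c ++ mirror a) ++ mirror a         ≡⟨ cong (_++ mirror a) (mirror-++ c (mirror a)) ⟩
    (mirror (mirror a) ++ mirror c) ++ mirror a ≡⟨ cong (λ t → (t ++ mirror c) ++ mirror a) (mirror-involutive a) ⟩
    (a ++ mirror c) ++ mirror a                ≡⟨ cong (λ t → (a ++ t) ++ mirror a) (mirror-centre C) ⟩
    (a ++ c) ++ mirror a                       ≡⟨ LP.++-assoc a c (mirror a) ⟩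
    a ++ c ++ mirror a                         ∎
    where open ≡-Reasoning

  symmetric-inner : ∀ x zs y → mirror (x ∷ (zs ∷ʳ y)) ≡ x ∷ (zs ∷ʳ y) → mirror zs ≡ zs × f x ≡ y
  symmetric-inner x zs y e = LP.∷ʳ-injective (mirror zs) zs (LP.∷-injectiveʳ e')
    where
    e' : f y ∷ (mirror zs ∷ʳ f x) ≡ x ∷ (zs ∷ʳ y)
    e' = begin
      f y ∷ (mirror zs ∷ʳ f x)    ≡⟨ cong (_++ [ f x ]) (mirror-++ zs [ y ]) ⟨
      mirror (zs ∷ʳ y) ∷ʳ f x     ≡⟨ mirror-++ [ x ] (zs ∷ʳ y) ⟨
      mirror (x ∷ (zs ∷ʳ y))      ≡⟨ e ⟩
      x ∷ (zs ∷ʳ y)               ∎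
      where open ≡-Reasoning

  split-bounded : ∀ n xs → length xs ≤ n → mirror xs ≡ xs → Split xs
  split-bounded _       []       _         _ = split [] [] none refl
  split-bounded (suc n) (x ∷ ys) (s≤s ≤n) e with initLast ys
  ... | [] = split [] [ x ] (fixed (LP.∷-injectiveˡ e)) refl
  ... | zs ∷ʳ′ y with symmetric-inner x zs y e
  ...   | inner , fx≡y with split-bounded n zs (ℕP.≤-trans (LP.length-++-≤ˡ zs) ≤n) inner
  ...     | split a c C refl = split (x ∷ a) c C (cong (x ∷_) (begin
    (a ++ c ++ mirror a) ∷ʳ y        ≡⟨ LP.++-assoc a (c ++ mirror a) [ y ] ⟩
    a ++ (c ++ mirror a) ∷ʳ y        ≡⟨ cong (a ++_) (LP.++-assoc c (mirror a) [ y ]) ⟩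
    a ++ c ++ mirror a ∷ʳ y          ≡⟨ cong (λ t → a ++ c ++ mirror a ∷ʳ t) fx≡y ⟨
    a ++ c ++ mirror a ∷ʳ f x        ≡⟨ cong (λ t → a ++ c ++ t) (mirror-++ [ x ] a) ⟨
    a ++ c ++ mirror (x ∷ a)         ∎))
    where open ≡-Reasoning

  symmetric-split : ∀ xs → mirror xs ≡ xs → Split xs
  symmetric-split xs = split-bounded (length xs) xs ℕP.≤-refl

  split-unique : ∀ a a' {c c'} → Centre c → Centre c' →
                 a ++ c ++ mirror a ≡ a' ++ c' ++ mirror a' → a ≡ a'
  split-unique a a' {c} {c'} C C' e =
    ++-prefix-unique a a' (excess-unique (length a) (length a')
      (trans (sym (len a c)) (trans (cong length e) (len a' c')))
      (centre-length C) (centre-length C')) e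
    where
    len : ∀ a c → length (a ++ c ++ mirror a) ≡ length a + (length c + length a)
    len a c = trans (LP.length-++ a)
      (cong (_+_ (length a)) (trans (LP.length-++ c) (cong (_+_ (length c)) (length-mirror a))))

flipStep-involutive : ∀ {k} (s : Step k) → flipStep (flipStep s) ≡ s
flipStep-involutive up          = refl
flipStep-involutive down        = refl
flipStep-involutive (hor _ _ _) = refl

open module StepMirror {k : ℕ} = Mirror (flipStep {k}) flipStep-involutive
  using (Centre; none; fixed; Split; split; split-symmetric; symmetric-split; split-unique)
  renaming (mirror-++ to reflect-++)

module _ {k : ℕ} where

  width-++ : ∀ (a b : List (Step k)) → width (a ++ b) ≡ width a + width b
  width-++ []      b = refl
  width-++ (s ∷ a) b = trans (cong (_+_ (stepWidth s)) (width-++ a b)) (sym (ℕP.+-assoc (stepWidth s) _ _))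

  rise-++ : ∀ (a b : List (Step k)) → rise (a ++ b) ≡ rise a ℤ.+ rise b
  rise-++ []      b = sym (ℤP.+-identityˡ (rise b))
  rise-++ (s ∷ a) b = trans (cong (ℤ._+_ (stepRise s)) (rise-++ a b)) (sym (ℤP.+-assoc (stepRise s) _ _))

  width-reflect : ∀ (a : List (Step k)) → width (reflect a) ≡ width a
  width-reflect []      = refl
  width-reflect (s ∷ a) = begin
    width (reflect (s ∷ a))                       ≡⟨ cong width (reflect-++ [ s ] a) ⟩
    width (reflect a ++ [ flipStep s ])           ≡⟨ width-++ (reflect a) [ flipStep s ] ⟩
    width (reflect a) + (stepWidth (flipStep s) + 0) ≡⟨ cong₂ _+_ (width-reflect a) (ℕP.+-identityʳ _) ⟩
    width a + stepWidth (flipStep s)              ≡⟨ cong (_+_ (width a)) (width-flip s) ⟩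
    width a + stepWidth s                         ≡⟨ ℕP.+-comm (width a) (stepWidth s) ⟩
    stepWidth s + width a                         ∎
    where
    open ≡-Reasoning
    width-flip : ∀ s → stepWidth (flipStep s) ≡ stepWidth s
    width-flip up          = refl
    width-flip down        = refl
    width-flip (hor _ _ _) = refl

  rise-reflect : ∀ (a : List (Step k)) → rise (reflect a) ≡ - rise a
  rise-reflect []      = refl
  rise-reflect (s ∷ a) = begin
    rise (reflect (s ∷ a))                               ≡⟨ cong rise (reflect-++ [ s ] a) ⟩
    rise (reflect a ++ [ flipStep s ])                   ≡⟨ rise-++ (reflect a) [ flipStep s ] ⟩
    rise (reflect a) ℤ.+ (stepRise (flipStep s) ℤ.+ 0ℤ)
      ≡⟨ cong₂ (λ x y → x ℤ.+ (y ℤ.+ 0ℤ)) (rise-reflect a) (rise-flip s) ⟩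
    - rise a ℤ.+ (- stepRise s ℤ.+ 0ℤ)                   ≡⟨ negate-sum (rise a) (stepRise s) ⟩
    - (stepRise s ℤ.+ rise a)                            ∎
    where
    open ≡-Reasoning
    rise-flip : ∀ s → stepRise (flipStep s) ≡ - stepRise s
    rise-flip up          = refl
    rise-flip down        = refl
    rise-flip (hor _ _ _) = refl
    negate-sum : ∀ r s → - r ℤ.+ (- s ℤ.+ 0ℤ) ≡ - (s ℤ.+ r)
    negate-sum = solve-∀

module _ {k : ℕ} where

  -- Heights are natural numbers here, which makes ballot paths easy to
  -- analyse by recursion; stays⇒ballot and ballot⇒stays relate this to
  -- StaysAbove.
  Ballot : ℕ → List (Step k) → Set
  Ballot d       []              = ⊤
  Ballot d       (up ∷ a)        = Ballot (suc d) a
  Ballot zero    (down ∷ a)      = ⊥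
  Ballot (suc d) (down ∷ a)      = Ballot d a
  Ballot d       (hor _ _ _ ∷ a) = Ballot d a

  -- The final height of a path started at height d (meaningful for ballot paths).
  final : ℕ → List (Step k) → ℕ
  final d []              = d
  final d (up ∷ a)        = final (suc d) a
  final d (down ∷ a)      = final (pred d) a
  final d (hor _ _ _ ∷ a) = final d a

  ballot? : ∀ d a → Dec (Ballot d a)
  ballot? d       []              = yes tt
  ballot? d       (up ∷ a)        = ballot? (suc d) a
  ballot? zero    (down ∷ a)      = no λ ()
  ballot? (suc d) (down ∷ a)      = ballot? d a
  ballot? d       (hor _ _ _ ∷ a) = ballot? d a

  Ballot-irrelevant : ∀ d a → Irrelevant (Ballot d a)
  Ballot-irrelevant d       []              _ _ = refl
  Ballot-irrelevant d       (up ∷ a)        = Ballot-irrelevant (suc d) a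
  Ballot-irrelevant (suc d) (down ∷ a)      = Ballot-irrelevant d a
  Ballot-irrelevant d       (hor _ _ _ ∷ a) = Ballot-irrelevant d a

  Ballot-suc : ∀ d a → Ballot d a → Ballot (suc d) a
  Ballot-suc d       []              _ = tt
  Ballot-suc d       (up ∷ a)        b = Ballot-suc (suc d) a b
  Ballot-suc (suc d) (down ∷ a)      b = Ballot-suc d a b
  Ballot-suc d       (hor _ _ _ ∷ a) b = Ballot-suc d a b

  final-suc : ∀ d a → Ballot d a → final (suc d) a ≡ suc (final d a)
  final-suc d       []              _ = refl
  final-suc d       (up ∷ a)        b = final-suc (suc d) a b
  final-suc (suc d) (down ∷ a)      b = final-suc d a b
  final-suc d       (hor _ _ _ ∷ a) b = final-suc d a b

  final-++ : ∀ d (a b : List (Step k)) → final d (a ++ b) ≡ final (final d a) b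
  final-++ d []              b = refl
  final-++ d (up ∷ a)        b = final-++ (suc d) a b
  final-++ d (down ∷ a)      b = final-++ (pred d) a b
  final-++ d (hor _ _ _ ∷ a) b = final-++ d a b

  Ballot-++⁻ : ∀ d (a b : List (Step k)) → Ballot d (a ++ b) → Ballot d a × Ballot (final d a) b
  Ballot-++⁻ d       []              b x = tt , x
  Ballot-++⁻ d       (up ∷ a)        b x = Ballot-++⁻ (suc d) a b x
  Ballot-++⁻ (suc d) (down ∷ a)      b x = Ballot-++⁻ d a b x
  Ballot-++⁻ d       (hor _ _ _ ∷ a) b x = Ballot-++⁻ d a b x

  Ballot-++⁺ : ∀ d (a b : List (Step k)) → Ballot d a → Ballot (final d a) b → Ballot d (a ++ b)
  Ballot-++⁺ d       []              b _ y = y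
  Ballot-++⁺ d       (up ∷ a)        b x y = Ballot-++⁺ (suc d) a b x y
  Ballot-++⁺ (suc d) (down ∷ a)      b x y = Ballot-++⁺ d a b x y
  Ballot-++⁺ d       (hor _ _ _ ∷ a) b x y = Ballot-++⁺ d a b x y

  Ballot-step-reflect : ∀ d s → Ballot d [ s ] →
                        Ballot (final d [ s ]) [ flipStep s ] × final (final d [ s ]) [ flipStep s ] ≡ d
  Ballot-step-reflect d       up          _ = tt , refl
  Ballot-step-reflect (suc d) down        _ = tt , refl
  Ballot-step-reflect d       (hor _ _ _) _ = tt , refl

  Ballot-reflect : ∀ d a → Ballot d a →
                   Ballot (final d a) (reflect a) × final (final d a) (reflect a) ≡ d
  Ballot-reflect d []      _ = tt , refl
  Ballot-reflect d (s ∷ a) b rewrite final-++ d [ s ] a | reflect-++ [ s ] a =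
    let bs , ba   = Ballot-++⁻ d [ s ] a b
        br , fr   = Ballot-reflect (final d [ s ]) a ba
        bs' , fs' = Ballot-step-reflect d s bs
    in Ballot-++⁺ _ (reflect a) [ flipStep s ] br (subst (λ h → Ballot h [ flipStep s ]) (sym fr) bs') ,
       trans (final-++ _ (reflect a) [ flipStep s ]) (trans (cong (λ h → final h [ flipStep s ]) fr) fs')

  stays-at : ∀ {d d'} (p : List (Step k)) → d ≡ d' → StaysAbove (+ d) p → StaysAbove (+ d') p
  stays-at p = subst (λ h → StaysAbove (+ h) p)

  stays⇒ballot : ∀ d p → StaysAbove (+ d) p → Ballot d p
  stays⇒ballot d       []              _       = tt
  stays⇒ballot d       (up ∷ p)        (_ , s) = stays⇒ballot (suc d) p (stays-at p (ℕP.+-comm d 1) s)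
  stays⇒ballot zero    (down ∷ p)      (() , _)
  stays⇒ballot (suc d) (down ∷ p)      (_ , s) = stays⇒ballot d p s
  stays⇒ballot d       (hor _ _ _ ∷ p) (_ , s) = stays⇒ballot d p (stays-at p (ℕP.+-identityʳ d) s)

  ballot⇒stays : ∀ d p → Ballot d p → StaysAbove (+ d) p
  ballot⇒stays d       []              _ = tt
  ballot⇒stays d       (up ∷ p)        b = ℤ.+≤+ z≤n , stays-at p (ℕP.+-comm 1 d) (ballot⇒stays (suc d) p b)
  ballot⇒stays (suc d) (down ∷ p)      b = ℤ.+≤+ z≤n , ballot⇒stays d p b
  ballot⇒stays d       (hor _ _ _ ∷ p) b = ℤ.+≤+ z≤n , stays-at p (sym (ℕP.+-identityʳ d)) (ballot⇒stays d p b)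

  StaysAbove-irrelevant : ∀ h (p : List (Step k)) → Irrelevant (StaysAbove h p)
  StaysAbove-irrelevant h []      _       _         = refl
  StaysAbove-irrelevant h (s ∷ p) (x , y) (x' , y') =
    cong₂ _,_ (ℤP.≤-irrelevant x x') (StaysAbove-irrelevant _ p y y')

module _ {k : ℕ} where

  EndsLow : List (Step k) → Set
  EndsLow p = rise p ≡ 0ℤ ⊎ rise p ≡ -1ℤ

  -- A path cannot end at both heights, so EndsLow has unique proofs.
  EndsLow-irrelevant : ∀ p → Irrelevant (EndsLow p)
  EndsLow-irrelevant p (inj₁ x) (inj₁ y) = cong inj₁ (uip x y)
  EndsLow-irrelevant p (inj₁ x) (inj₂ y) with () ← trans (sym x) y
  EndsLow-irrelevant p (inj₂ x) (inj₁ y) with () ← trans (sym x) y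
  EndsLow-irrelevant p (inj₂ x) (inj₂ y) = cong inj₂ (uip x y)

  -- raise d p turns the free path p into a ballot path: d is the height of
  -- p above its running minimum, and every down step reaching a new minimum
  -- is replaced by an up step.
  raise : ℕ → List (Step k) → List (Step k)
  raise d       []              = []
  raise d       (up ∷ p)        = up ∷ raise (suc d) p
  raise zero    (down ∷ p)      = up ∷ raise zero p
  raise (suc d) (down ∷ p)      = down ∷ raise d p
  raise d       (hor l x y ∷ p) = hor l x y ∷ raise d p

  newMinima : ℕ → List (Step k) → ℕ
  newMinima d       []              = 0
  newMinima d       (up ∷ p)        = newMinima (suc d) p
  newMinima zero    (down ∷ p)      = suc (newMinima zero p)
  newMinima (suc d) (down ∷ p)      = newMinima d p
  newMinima d       (hor _ _ _ ∷ p) = newMinima d p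

  width-raise : ∀ d p → width (raise d p) ≡ width p
  width-raise d       []              = refl
  width-raise d       (up ∷ p)        = cong (_+_ k) (width-raise (suc d) p)
  width-raise zero    (down ∷ p)      = cong (_+_ k) (width-raise zero p)
  width-raise (suc d) (down ∷ p)      = cong (_+_ k) (width-raise d p)
  width-raise d       (hor l _ _ ∷ p) = cong (_+_ l) (width-raise d p)

  raise-ballot : ∀ d p → Ballot d (raise d p)
  raise-ballot d       []              = tt
  raise-ballot d       (up ∷ p)        = raise-ballot (suc d) p
  raise-ballot zero    (down ∷ p)      = Ballot-suc zero (raise zero p) (raise-ballot zero p)
  raise-ballot (suc d) (down ∷ p)      = raise-ballot d p
  raise-ballot d       (hor _ _ _ ∷ p) = raise-ballot d p

  -- Each turned step adds 2 to the final height: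
  -- final height of raise d p = d + rise p + 2 · newMinima d p.
  final-raise : ∀ d p → let f = newMinima d p in
                + final d (raise d p) ≡ + d ℤ.+ rise p ℤ.+ (+ f ℤ.+ + f)
  final-raise d [] = start (+ d)
    where
    start : ∀ d → d ≡ d ℤ.+ 0ℤ ℤ.+ (0ℤ ℤ.+ 0ℤ)
    start = solve-∀
  final-raise d (up ∷ p) = trans (final-raise (suc d) p) (shift (+ d) (rise p) _)
    where
    shift : ∀ d r F → 1ℤ ℤ.+ d ℤ.+ r ℤ.+ F ≡ d ℤ.+ (1ℤ ℤ.+ r) ℤ.+ F
    shift = solve-∀
  final-raise zero (down ∷ p) = begin
    + final 1 q                           ≡⟨ cong +_ (final-suc zero q (raise-ballot zero p)) ⟩
    1ℤ ℤ.+ + final 0 q                    ≡⟨ cong (ℤ._+_ 1ℤ) (final-raise zero p) ⟩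
    1ℤ ℤ.+ (0ℤ ℤ.+ rise p ℤ.+ (F ℤ.+ F))  ≡⟨ turn (rise p) F ⟩
    0ℤ ℤ.+ (-1ℤ ℤ.+ rise p) ℤ.+ ((1ℤ ℤ.+ F) ℤ.+ (1ℤ ℤ.+ F)) ∎
    where
    open ≡-Reasoning
    q = raise zero p
    F = + newMinima zero p
    turn : ∀ r F → 1ℤ ℤ.+ (0ℤ ℤ.+ r ℤ.+ (F ℤ.+ F)) ≡
                   0ℤ ℤ.+ (-1ℤ ℤ.+ r) ℤ.+ ((1ℤ ℤ.+ F) ℤ.+ (1ℤ ℤ.+ F))
    turn = solve-∀
  final-raise (suc d) (down ∷ p) = trans (final-raise d p) (shift (+ d) (rise p) _)
    where
    shift : ∀ d r F → d ℤ.+ r ℤ.+ F ≡ 1ℤ ℤ.+ d ℤ.+ (-1ℤ ℤ.+ r) ℤ.+ F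
    shift = solve-∀
  final-raise d (hor _ _ _ ∷ p) = trans (final-raise d p) (flat (+ d) (rise p) _)
    where
    flat : ∀ d r F → d ℤ.+ r ℤ.+ F ≡ d ℤ.+ (0ℤ ℤ.+ r) ℤ.+ F
    flat = solve-∀

  raise-not-ballot : ∀ d p → 0 < newMinima (suc d) p → ¬ Ballot d (raise (suc d) p)
  raise-not-ballot d       []              ()
  raise-not-ballot d       (up ∷ p)        f>0 = raise-not-ballot (suc d) p f>0
  raise-not-ballot zero    (down ∷ p)      f>0 = λ ()
  raise-not-ballot (suc d) (down ∷ p)      f>0 = raise-not-ballot d p f>0
  raise-not-ballot d       (hor _ _ _ ∷ p) f>0 = raise-not-ballot d p f>0

  -- lower r d a undoes raise, given the number r of up steps to turn back
  -- into down steps; d is again the height above the running minimum of the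
  -- path being rebuilt.  An up step is turned exactly when turns remain, the
  -- rebuilt path is at its minimum, and the ballot path never comes back
  -- below the top of that step.
  Turn : ℕ → ℕ → List (Step k) → Set
  Turn r d a = 0 < r × d ≡ 0 × Ballot 0 a

  turn? : ∀ r d a → Dec (Turn r d a)
  turn? r d a = (0 ℕ.<? r) ×-dec (d ℕ.≟ 0) ×-dec ballot? 0 a

  lower : ℕ → ℕ → List (Step k) → List (Step k)
  lower r d []              = []
  lower r d (up ∷ a) with turn? r d a
  ... | yes _ = down ∷ lower (pred r) d a
  ... | no  _ = up ∷ lower r (suc d) a
  lower r d (down ∷ a)      = down ∷ lower r (pred d) a
  lower r d (hor l x y ∷ a) = hor l x y ∷ lower r d a

  TouchesZero : ℕ → List (Step k) → Set
  TouchesZero d       []              = ⊥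
  TouchesZero d       (up ∷ a)        = TouchesZero (suc d) a
  TouchesZero zero    (down ∷ a)      = ⊤
  TouchesZero (suc d) (down ∷ a)      = d ≡ 0 ⊎ TouchesZero d a
  TouchesZero d       (hor _ _ _ ∷ a) = TouchesZero d a

  touches-zero : ∀ d a → Ballot (suc d) a → ¬ Ballot d a → TouchesZero (suc d) a
  touches-zero d       []              _ nb = nb tt
  touches-zero d       (up ∷ a)        b nb = touches-zero (suc d) a b nb
  touches-zero zero    (down ∷ a)      _ _  = inj₁ refl
  touches-zero (suc d) (down ∷ a)      b nb = inj₂ (touches-zero d a b nb)
  touches-zero d       (hor _ _ _ ∷ a) b nb = touches-zero d a b nb

  -- The invariant of lower: while turns remain, the rebuilt path is at its
  -- minimum or will return to it, so that raise turns back exactly the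
  -- steps turned by lower.
  Pending : ℕ → ℕ → List (Step k) → Set
  Pending r d a = 0 < r → d ≡ 0 ⊎ TouchesZero d a

  pending-up : ∀ r d a → Ballot (suc d) a → ¬ Turn r d a → Pending r d (up ∷ a) → Pending r (suc d) a
  pending-up r d a b ¬turn pend r>0 with pend r>0
  ... | inj₁ refl = inj₂ (touches-zero 0 a b λ b0 → ¬turn (r>0 , refl , b0))
  ... | inj₂ t    = inj₂ t

  pending-down : ∀ r d a → Pending r (suc d) (down ∷ a) → Pending r d a
  pending-down r d a pend r>0 with pend r>0
  ... | inj₂ t = t

  raise-lower : ∀ r d a → Ballot d a → Pending r d a → raise d (lower r d a) ≡ a
  raise-lower r d []              _ _    = refl
  raise-lower r d (up ∷ a)        b pend with turn? r d a
  ... | yes (r>0 , refl , b0) = cong (up ∷_) (raise-lower (pred r) 0 a b0 λ _ → inj₁ refl)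
  ... | no ¬turn = cong (up ∷_) (raise-lower r (suc d) a b (pending-up r d a b ¬turn pend))
  raise-lower r (suc d) (down ∷ a) b pend = cong (down ∷_) (raise-lower r d a b (pending-down r d a pend))
  raise-lower r d (hor l x y ∷ a) b pend = cong (hor l x y ∷_) (raise-lower r d a b pend)

  newMinima-lower : ∀ r d a → Ballot d a → Pending r d a → r ≤ final d a → newMinima d (lower r d a) ≡ r
  newMinima-lower zero    d [] _ _ _ = refl
  newMinima-lower (suc r) d [] _ pend r≤d with pend (s≤s z≤n)
  ... | inj₁ refl = contradiction r≤d λ ()
  newMinima-lower r d (up ∷ a) b pend r≤h with turn? r d a
  ... | yes (s≤s z≤n , refl , b0) = cong suc (newMinima-lower _ 0 a b0 (λ _ → inj₁ refl)
          (ℕP.≤-pred (subst (r ≤_) (final-suc 0 a b0) r≤h)))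
  ... | no ¬turn = newMinima-lower r (suc d) a b (pending-up r d a b ¬turn pend) r≤h
  newMinima-lower r (suc d) (down ∷ a) b pend r≤h = newMinima-lower r d a b (pending-down r d a pend) r≤h
  newMinima-lower r d (hor _ _ _ ∷ a) b pend r≤h = newMinima-lower r d a b pend r≤h

  lower-raise : ∀ d p → lower (newMinima d p) d (raise d p) ≡ p
  lower-raise d [] = refl
  lower-raise d (up ∷ p) with turn? (newMinima (suc d) p) d (raise (suc d) p)
  ... | yes (f>0 , refl , b) = contradiction b (raise-not-ballot 0 p f>0)
  ... | no _ = cong (up ∷_) (lower-raise (suc d) p)
  lower-raise zero (down ∷ p) with turn? (suc (newMinima zero p)) zero (raise zero p)
  ... | yes _    = cong (down ∷_) (lower-raise zero p)
  ... | no ¬turn = contradiction (s≤s z≤n , refl , raise-ballot zero p) ¬turn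
  lower-raise (suc d) (down ∷ p) = cong (down ∷_) (lower-raise d p)
  lower-raise d (hor l x y ∷ p) = cong (hor l x y ∷_) (lower-raise d p)

  width-lower : ∀ r d a → width (lower r d a) ≡ width a
  width-lower r d [] = refl
  width-lower r d (up ∷ a) with turn? r d a
  ... | yes _ = cong (_+_ k) (width-lower (pred r) d a)
  ... | no  _ = cong (_+_ k) (width-lower r (suc d) a)
  width-lower r d (down ∷ a)      = cong (_+_ k) (width-lower r (pred d) a)
  width-lower r d (hor l _ _ ∷ a) = cong (_+_ l) (width-lower r d a)

  final-raise₀ : ∀ p → let f = newMinima 0 p in + final 0 (raise 0 p) ≡ rise p ℤ.+ + (f + f)
  final-raise₀ p = trans (final-raise 0 p) (cong (λ r → r ℤ.+ + (f + f)) (ℤP.+-identityˡ (rise p)))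
    where f = newMinima 0 p

module _ {k : ℕ} where

  toLow : List (Step k) → List (Step k)
  toLow a = lower ⌈ final 0 a /2⌉ 0 a

  -- raise undoes toLow, and toLow a ends at 0 or -1 since exactly ⌈h/2⌉
  -- steps are turned, each lowering the final height by 2.
  raise-toLow : ∀ a → Ballot 0 a → raise 0 (toLow a) ≡ a
  raise-toLow a b = raise-lower ⌈ final 0 a /2⌉ 0 a b (λ _ → inj₁ refl)

  toLow-low : ∀ a → Ballot 0 a → EndsLow (toLow a)
  toLow-low a b = half⇒low h (rise p) (begin
    + h                          ≡⟨ cong (λ q → + final 0 q) (raise-toLow a b) ⟨
    + final 0 (raise 0 p)        ≡⟨ final-raise₀ p ⟩
    rise p ℤ.+ + (f + f)         ≡⟨ cong (λ n → rise p ℤ.+ + (n + n)) f≡c ⟩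
    rise p ℤ.+ + (c + c)         ∎)
    where
    open ≡-Reasoning
    h = final 0 a
    c = ⌈ h /2⌉
    p = toLow a
    f = newMinima 0 p
    f≡c : f ≡ c
    f≡c = newMinima-lower c 0 a b (λ _ → inj₁ refl) (ℕP.⌈n/2⌉≤n h)

  -- toLow undoes raise on paths ending at 0 or -1: for them newMinima 0 p
  -- is half the final height of raise 0 p, rounded up.
  toLow-raise : ∀ p → EndsLow p → toLow (raise 0 p) ≡ p
  toLow-raise p low = trans (cong (λ c → lower c 0 (raise 0 p)) c≡f) (lower-raise 0 p)
    where
    c≡f : ⌈ final 0 (raise 0 p) /2⌉ ≡ newMinima 0 p
    c≡f = low⇒half _ _ (rise p) (final-raise₀ p) low

  width-toLow : ∀ a → width (toLow a) ≡ width a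
  width-toLow a = width-lower ⌈ final 0 a /2⌉ 0 a

hor-≡ : ∀ {k l l'} {p q p' q'} → l ≡ l' → hor {k} l p q ≡ hor l' p' q'
hor-≡ {p = p} {q} {p'} {q'} refl = cong₂ (hor _) (ℕP.≤-irrelevant p p') (ℕP.≤-irrelevant q q')

module _ {k : ℕ} where

  width-symmetric : ∀ (a c : List (Step k)) → width (a ++ c ++ reflect a) ≡ width a + (width c + width a)
  width-symmetric a c = trans (width-++ a (c ++ reflect a))
    (cong (_+_ (width a)) (trans (width-++ c (reflect a)) (cong (_+_ (width c)) (width-reflect a))))

  rise-symmetric : ∀ (a c : List (Step k)) → rise c ≡ 0ℤ → rise (a ++ c ++ reflect a) ≡ 0ℤ
  rise-symmetric a c flat = begin
    rise (a ++ c ++ reflect a)                   ≡⟨ rise-++ a (c ++ reflect a) ⟩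
    rise a ℤ.+ rise (c ++ reflect a)             ≡⟨ cong (ℤ._+_ (rise a)) (rise-++ c (reflect a)) ⟩
    rise a ℤ.+ (rise c ℤ.+ rise (reflect a))
      ≡⟨ cong₂ (λ x y → rise a ℤ.+ (x ℤ.+ y)) flat (rise-reflect a) ⟩
    rise a ℤ.+ (0ℤ ℤ.+ - rise a)                 ≡⟨ cancel (rise a) ⟩
    0ℤ                                           ∎
    where
    open ≡-Reasoning
    cancel : ∀ r → r ℤ.+ (0ℤ ℤ.+ - r) ≡ 0ℤ
    cancel = solve-∀

  centre-rise : ∀ {c : List (Step k)} → Centre c → rise c ≡ 0ℤ
  centre-rise none                  = refl
  centre-rise (fixed {hor _ _ _} _) = refl

  centre-ballot : ∀ {c : List (Step k)} d → Centre c → Ballot d c × final d c ≡ d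
  centre-ballot d none                  = tt , refl
  centre-ballot d (fixed {hor _ _ _} _) = tt , refl

  Ballot-symmetric : ∀ a {c : List (Step k)} → Centre c → Ballot 0 a → Ballot 0 (a ++ c ++ reflect a)
  Ballot-symmetric a {c} C b =
    Ballot-++⁺ 0 a (c ++ reflect a) b (Ballot-++⁺ h c (reflect a) bc
      (subst (λ d → Ballot d (reflect a)) (sym fc) (proj₁ (Ballot-reflect 0 a b))))
    where
    h = final 0 a
    bc = proj₁ (centre-ballot h C)
    fc = proj₂ (centre-ballot h C)

-- A symmetric Dyck path of width 2m is determined by its left half a, a
-- ballot path, and its centre, a horizontal step of even width 2j < 2k
-- (nothing when j = 0), where width a + j = m.
Halves : ℕ → ℕ → Set
Halves m k = Σ (ℕ × List (Step k)) λ (j , a) → j < k × width a + j ≡ m × Ballot 0 a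

Halves-≡ : ∀ {m k} {h h' : Halves m k} → proj₁ h ≡ proj₁ h' → h ≡ h'
Halves-≡ = Σ-≡ λ (j , a) → ×-irrelevant ℕP.<-irrelevant (×-irrelevant uip (Ballot-irrelevant 0 a))

SD-≡ : ∀ {n k} {s t : SD n k} → proj₁ s ≡ proj₁ t → s ≡ t
SD-≡ = Σ-≡ λ p → ×-irrelevant uip (×-irrelevant uip (×-irrelevant (StaysAbove-irrelevant 0ℤ p) uip))

module _ {k : ℕ} where

  centreOf : ∀ j → j < suc k → List (Step (suc k))
  centreOf zero    _   = []
  centreOf (suc j) j<K = [ hor (2 * suc j) (s≤s z≤n) (ℕP.*-monoʳ-< 2 j<K) ]

  centreOf-centre : ∀ j (j<K : j < suc k) → Centre (centreOf j j<K)
  centreOf-centre zero    _ = none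
  centreOf-centre (suc j) _ = fixed refl

  width-centreOf : ∀ j (j<K : j < suc k) → width (centreOf j j<K) ≡ 2 * j
  width-centreOf zero    _ = refl
  width-centreOf (suc j) _ = ℕP.+-identityʳ (2 * suc j)

  centre-width : ∀ {c : List (Step (suc k))} → Centre c → width c < 2 * suc k
  centre-width none                     = s≤s z≤n
  centre-width (fixed {hor l _ l<2K} _) = subst (_< 2 * suc k) (sym (ℕP.+-identityʳ l)) l<2K

  centreOf-unique : ∀ j (j<K : j < suc k) {c} → Centre c → width c ≡ 2 * j → centreOf j j<K ≡ c
  centreOf-unique zero    _ none                        _ = refl
  centreOf-unique zero    _ (fixed {hor (suc _) _ _} _) ()
  centreOf-unique (suc j) _ (fixed {hor l _ _} _)       e = cong [_] (hor-≡ (trans (sym e) (ℕP.+-identityʳ l)))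

module _ {m k : ℕ} where

  assemble : Halves m (suc k) → SD (2 * m) (suc k)
  assemble ((j , a) , j<K , w , b) =
    a ++ c ++ reflect a ,
    (begin
      width (a ++ c ++ reflect a)      ≡⟨ width-symmetric a c ⟩
      width a + (width c + width a)    ≡⟨ cong (λ x → width a + (x + width a)) (width-centreOf j j<K) ⟩
      width a + (2 * j + width a)      ≡⟨ halves-sum (width a) j ⟩
      2 * (width a + j)                ≡⟨ cong (2 *_) w ⟩
      2 * m                            ∎) ,
    rise-symmetric a c (centre-rise C) ,
    ballot⇒stays 0 _ (Ballot-symmetric a C b) ,
    split-symmetric a C
    where
    open ≡-Reasoning
    c = centreOf j j<K
    C = centreOf-centre j j<K
    halves-sum : ∀ a j → a + (2 * j + a) ≡ 2 * (a + j)
    halves-sum = ℕSolver.solve-∀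

  split-widths : ∀ (s : SD (2 * m) (suc k)) (P : Split (proj₁ s)) →
                 let open Split P in width half ≤ m × width centre ≡ 2 * (m ∸ width half)
  split-widths (p , W , _) (split a c _ shape) =
    halve (width a) (width c) m (trans (sym (width-symmetric a c)) (trans (cong width (sym shape)) W))

  disassemble : (s : SD (2 * m) (suc k)) → Split (proj₁ s) → Halves m (suc k)
  disassemble s@(p , _ , _ , S , _) P@(split a c C shape) =
    (m ∸ width a , a) ,
    ℕP.*-cancelˡ-< 2 _ _ (subst (_< 2 * suc k) c≡ (centre-width C)) ,
    ℕP.m+[n∸m]≡n a≤m ,
    proj₁ (Ballot-++⁻ 0 a _ (subst (Ballot 0) shape (stays⇒ballot 0 p S)))
    where
    a≤m = proj₁ (split-widths s P)
    c≡  = proj₂ (split-widths s P)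

  assemble-disassemble : ∀ s P → assemble (disassemble s P) ≡ s
  assemble-disassemble s@(p , _) P@(split a c C shape) = SD-≡ (begin
    a ++ centreOf (m ∸ width a) _ ++ reflect a
      ≡⟨ cong (λ x → a ++ x ++ reflect a) (centreOf-unique _ _ C (proj₂ (split-widths s P))) ⟩
    a ++ c ++ reflect a                          ≡⟨ shape ⟨
    p                                            ∎)
    where open ≡-Reasoning

  disassemble-assemble : ∀ h P → disassemble (assemble h) P ≡ h
  disassemble-assemble ((j , a) , j<K , w , _) (split a' _ C' shape) = Halves-≡ (cong₂ _,_ j'≡j (sym a≡a'))
    where
    a≡a' : a ≡ a'
    a≡a' = split-unique a a' (centreOf-centre j j<K) C' shape
    j'≡j : m ∸ width a' ≡ j
    j'≡j = begin
      m ∸ width a'            ≡⟨ cong (λ x → m ∸ width x) a≡a' ⟨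
      m ∸ width a             ≡⟨ cong (_∸ width a) w ⟨
      width a + j ∸ width a   ≡⟨ ℕP.m+n∸m≡n (width a) j ⟩
      j                       ∎
      where open ≡-Reasoning

  splitOf : (s : SD (2 * m) (suc k)) → Split (proj₁ s)
  splitOf (p , _ , _ , _ , symmetric) = symmetric-split p symmetric

  SD↔Halves : SD (2 * m) (suc k) ↔ Halves m (suc k)
  SD↔Halves = mk↔ₛ′ (λ s → disassemble s (splitOf s)) assemble
    (λ h → disassemble-assemble h (splitOf (assemble h))) (λ s → assemble-disassemble s (splitOf s))

LowHalves : ℕ → ℕ → Set
LowHalves m k = Σ (ℕ × List (Step k)) λ (j , p) → j < k × width p + j ≡ m × EndsLow p

LowHalves-≡ : ∀ {m k} {h h' : LowHalves m k} → proj₁ h ≡ proj₁ h' → h ≡ h'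
LowHalves-≡ = Σ-≡ λ (j , p) → ×-irrelevant ℕP.<-irrelevant (×-irrelevant uip (EndsLow-irrelevant p))

Halves↔LowHalves : ∀ {m k} → Halves m k ↔ LowHalves m k
Halves↔LowHalves = mk↔ₛ′ toLowHalf fromLowHalf
  (λ ((j , p) , _ , _ , low) → LowHalves-≡ (cong (j ,_) (toLow-raise p low)))
  (λ ((j , a) , _ , _ , b)   → Halves-≡ (cong (j ,_) (raise-toLow a b)))
  where
  toLowHalf : ∀ {m k} → Halves m k → LowHalves m k
  toLowHalf ((j , a) , j<k , w , b) = (j , toLow a) , j<k , trans (cong (_+ j) (width-toLow a)) w , toLow-low a b
  fromLowHalf : ∀ {m k} → LowHalves m k → Halves m k
  fromLowHalf ((j , p) , j<k , w , _) = (j , raise 0 p) , j<k , trans (cong (_+ j) (width-raise 0 p)) w , raise-ballot 0 p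

width-minus⁺ : ∀ {w i m} → w + i ≡ m → + w ≡ + m ℤ.- + i
width-minus⁺ {w} {i} e = trans (sym (cancel (+ w) (+ i))) (cong (λ n → + n ℤ.- + i) e)
  where
  cancel : ∀ x y → x ℤ.+ y ℤ.- y ≡ x
  cancel = solve-∀

width-minus⁻ : ∀ {w i m} → + w ≡ + m ℤ.- + i → w + i ≡ m
width-minus⁻ {w} {i} {m} e = ℤP.+-injective (trans (cong (ℤ._+ + i) e) (cancel (+ m) (+ i)))
  where
  cancel : ∀ x y → x ℤ.- y ℤ.+ y ≡ x
  cancel = solve-∀

width-succ⁺ : ∀ x y {m} → y + x ≡ m → + (suc x + y) ≡ + m ℤ.+ 1ℤ
width-succ⁺ x y {m} e = cong +_ (trans (cong suc (trans (ℕP.+-comm x y) e)) (ℕP.+-comm 1 m))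

width-succ⁻ : ∀ x y {m} → + (suc x + y) ≡ + m ℤ.+ 1ℤ → y + x ≡ m
width-succ⁻ x y {m} e = trans (ℕP.+-comm y x) (ℕP.suc-injective (trans (ℤP.+-injective e) (ℕP.+-comm m 1)))

after-down⁺ : ∀ {r} → r ≡ 0ℤ → -1ℤ ℤ.+ r ≡ -1ℤ
after-down⁺ refl = refl

after-down⁻ : ∀ {r} → -1ℤ ℤ.+ r ≡ -1ℤ → r ≡ 0ℤ
after-down⁻ {r} e = ∙-cancelˡ -1ℤ r 0ℤ e

after-flat : ∀ {r} → 0ℤ ℤ.+ r ≡ r
after-flat {r} = ℤP.+-identityˡ r

after-up⁺ : ∀ {r} → 1ℤ ℤ.+ r ≡ 0ℤ → 0ℤ ℤ.+ r ≡ -1ℤ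
after-up⁺ {r} e = trans after-flat (∙-cancelˡ 1ℤ r -1ℤ e)

after-up⁻ : ∀ {r} → 0ℤ ℤ.+ r ≡ -1ℤ → 1ℤ ℤ.+ r ≡ 0ℤ
after-up⁻ {r} e = cong (ℤ._+_ 1ℤ) (trans (sym (after-flat {r})) e)

module _ {k : ℕ} where

  -- Widths of horizontal steps: j + 1 for j < K = k + 1 ("short" steps),
  -- and j + 1 + K for j < k ("long" steps).
  short-bound : ∀ {j} → j < suc k → suc j < 2 * suc k
  short-bound {j} j<K = subst (suc (suc j) ≤_) (sym (double (suc k))) (ℕP.+-mono-≤ (s≤s z≤n) j<K)

  long-bound : ∀ {j} → j < k → suc (j + suc k) < 2 * suc k
  long-bound {j} j<k = subst (suc (suc j) + suc k ≤_) (sym (double (suc k))) (ℕP.+-monoˡ-≤ (suc k) (s≤s j<k))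

  long-bound⁻ : ∀ {j} → suc (j + suc k) < 2 * suc k → j < k
  long-bound⁻ {j} l<2K = ℕ.s≤s⁻¹ (ℕP.+-cancelʳ-≤ (suc k) (suc (suc j)) (suc k)
    (subst (suc (suc j) + suc k ≤_) (double (suc k)) l<2K))

  Long : ℕ → Set
  Long l = Σ ℕ λ j → j < k × l ≡ j + suc k

  long : ∀ {l} → ¬ suc l ≤ suc k → suc l < 2 * suc k → Long l
  long {l} l≰K l<2K = l ∸ suc k , long-bound⁻ (subst (λ x → suc x < 2 * suc k) l≡ l<2K) , l≡
    where
    l≡ : l ≡ l ∸ suc k + suc k
    l≡ = sym (ℕP.m∸n+n≡m (ℕ.s≤s⁻¹ (ℕP.≰⇒> l≰K)))

  long-offset : ∀ {j} (L : Long (j + suc k)) → proj₁ L ≡ j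
  long-offset (_ , _ , e) = sym (ℕP.+-cancelʳ-≡ (suc k) _ _ e)

FirstNotUp-irrelevant : ∀ {k} (p : List (Step k)) → Irrelevant (FirstNotUp p)
FirstNotUp-irrelevant []              _ _ = refl
FirstNotUp-irrelevant (down ∷ _)      _ _ = refl
FirstNotUp-irrelevant (hor _ _ _ ∷ _) _ _ = refl

FB'-≡ : ∀ {s k n} {x y : FB' s k n} → proj₁ x ≡ proj₁ y → x ≡ y
FB'-≡ = Σ-≡ λ p → ×-irrelevant uip (×-irrelevant uip (FirstNotUp-irrelevant p))

module _ {k : ℕ} where

  data UpView : List (Step k) → Set where
    startsUp : ∀ q → UpView (up ∷ q)
    notUp    : ∀ {p} → FirstNotUp p → UpView p

  upView : ∀ p → UpView p
  upView []              = notUp tt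
  upView (up ∷ q)        = startsUp q
  upView (down ∷ _)      = notUp tt
  upView (hor _ _ _ ∷ _) = notUp tt

-- (K + w) + j = w + (j + K): the width of an up step followed by q, plus j,
-- is the width of q plus that of a long horizontal step.
regroup : ∀ K w j → (K + w) + j ≡ w + (j + K)
regroup = ℕSolver.solve-∀

module _ {m k : ℕ} where

  Q₁-≡ : ∀ {i i' : Fin k} {x y} → toℕ i ≡ toℕ i' → proj₁ x ≡ proj₁ y →
         _≡_ {A = Q m (suc k)} (inj₁ (i , x)) (inj₁ (i' , y))
  Q₁-≡ {i} e e' with FP.toℕ-injective {i = i} e
  ... | refl = cong (λ z → inj₁ (i , z)) (FB'-≡ e')

  Q₂-≡ : ∀ {x y} → proj₁ x ≡ proj₁ y → _≡_ {A = Q m (suc k)} (inj₂ x) (inj₂ y)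
  Q₂-≡ e = cong inj₂ (FB'-≡ e)

  toQ₀ : ∀ j p → width p + j ≡ m → rise p ≡ 0ℤ → j < k ⊎ j ≡ k → UpView p → Q m (suc k)
  toQ₀ j p w r (inj₂ refl) _ =
    inj₂ (down ∷ p , width-succ⁺ k (width p) w , after-down⁺ r , tt)
  toQ₀ j .(up ∷ q) w r (inj₁ j<k) (startsUp q) =
    inj₂ (hor (suc (j + suc k)) (s≤s z≤n) (long-bound j<k) ∷ q ,
          width-succ⁺ (j + suc k) (width q) (trans (sym (regroup (suc k) (width q) j)) w) , after-up⁺ {rise q} r , tt)
  toQ₀ j p w r (inj₁ j<k) (notUp nu) =
    inj₁ (fromℕ< j<k , p , width-minus⁺ (trans (cong (_+_ (width p)) (FP.toℕ-fromℕ< j<k)) w) , r , nu)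

  toQ : LowHalves m (suc k) → Q m (suc k)
  toQ ((j , p) , j<K , w , inj₂ r) =
    inj₂ (hor (suc j) (s≤s z≤n) (short-bound j<K) ∷ p , width-succ⁺ j (width p) w , trans after-flat r , tt)
  toQ ((j , p) , j<K , w , inj₁ r) = toQ₀ j p w r (ℕP.m<1+n⇒m<n∨m≡n j<K) (upView p)

  fromLong : ∀ {l} (l≥1 : 1 ≤ suc l) (l<2K : suc l < 2 * suc k) q →
             + width (hor (suc l) l≥1 l<2K ∷ q) ≡ + m ℤ.+ 1ℤ →
             rise (hor {suc k} (suc l) l≥1 l<2K ∷ q) ≡ -1ℤ →
             Long {k} l → LowHalves m (suc k)
  fromLong _ _ q W r (j , j<k , refl) =
    (j , up ∷ q) , ℕP.m<n⇒m<1+n j<k ,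
    trans (regroup (suc k) (width q) j) (width-succ⁻ (j + suc k) (width q) W) ,
    inj₁ (after-up⁻ {rise q} r)

  fromLong-half : ∀ {l} {l≥1 : 1 ≤ suc l} {l<2K : suc l < 2 * suc k} q W r (L : Long {k} l) →
                  proj₁ (fromLong l≥1 l<2K q W r L) ≡ (proj₁ L , up ∷ q)
  fromLong-half _ _ _ (_ , _ , refl) = refl

  fromHor : ∀ {l} (l≥1 : 1 ≤ l) (l<2K : l < 2 * suc k) q →
            + width (hor l l≥1 l<2K ∷ q) ≡ + m ℤ.+ 1ℤ → rise (hor {suc k} l l≥1 l<2K ∷ q) ≡ -1ℤ →
            Dec (l ≤ suc k) → LowHalves m (suc k)
  fromHor {suc j} _ _ q W r (yes l≤K) = (j , q) , l≤K , width-succ⁻ j (width q) W , inj₂ (trans (sym after-flat) r)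
  fromHor {suc l} l≥1 l<2K q W r (no l≰K) = fromLong l≥1 l<2K q W r (long l≰K l<2K)

  fromQ : Q m (suc k) → LowHalves m (suc k)
  fromQ (inj₁ (i , p , W , r , _)) = (toℕ i , p) , ℕP.m<n⇒m<1+n (FP.toℕ<n i) , width-minus⁻ W , inj₁ r
  fromQ (inj₂ ([] , _ , () , _))
  fromQ (inj₂ (up ∷ q , _ , _ , ()))
  fromQ (inj₂ (down ∷ q , W , r , _)) = (k , q) , ℕP.n<1+n k , width-succ⁻ k (width q) W , inj₁ (after-down⁻ r)
  fromQ (inj₂ (hor l l≥1 l<2K ∷ q , W , r , _)) = fromHor l≥1 l<2K q W r (l ℕ.≤? suc k)

  toQ-fromQ : ∀ y → toQ (fromQ y) ≡ y
  toQ-fromQ (inj₁ (i , p , W , r , nu))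
    with ℕP.m<1+n⇒m<n∨m≡n (ℕP.m<n⇒m<1+n (FP.toℕ<n i)) | upView p
  ... | inj₂ i≡k  | _          = contradiction i≡k (ℕP.<⇒≢ (FP.toℕ<n i))
  ... | inj₁ _    | startsUp q = ⊥-elim nu
  ... | inj₁ i<k  | notUp _    = Q₁-≡ (FP.toℕ-fromℕ< i<k) refl
  toQ-fromQ (inj₂ ([] , _ , () , _))
  toQ-fromQ (inj₂ (up ∷ q , _ , _ , ()))
  toQ-fromQ (inj₂ (down ∷ q , W , r , _)) with ℕP.m<1+n⇒m<n∨m≡n (ℕP.n<1+n k) | upView q
  ... | inj₁ k<k  | _ = contradiction k<k (ℕP.n≮n k)
  ... | inj₂ refl | _ = Q₂-≡ refl
  toQ-fromQ (inj₂ (hor (suc l) l≥1 l<2K ∷ q , W , r , _)) with suc l ℕ.≤? suc k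
  ... | yes _ = Q₂-≡ (cong (_∷ q) (hor-≡ refl))
  ... | no l≰K = toQ-fromLong q W r (long l≰K l<2K)
    where
    toQ-fromLong : ∀ {l} {l≥1 : 1 ≤ suc l} {l<2K : suc l < 2 * suc k} q W r (L : Long {k} l) →
                   toQ (fromLong l≥1 l<2K q W r L) ≡ inj₂ (hor (suc l) l≥1 l<2K ∷ q , W , r , tt)
    toQ-fromLong q _ _ (j , j<k , refl) with ℕP.m<1+n⇒m<n∨m≡n (ℕP.m<n⇒m<1+n j<k)
    ... | inj₁ _   = Q₂-≡ (cong (_∷ q) (hor-≡ refl))
    ... | inj₂ j≡k = contradiction j≡k (ℕP.<⇒≢ j<k)

  fromQ-toQ : ∀ x → fromQ (toQ x) ≡ x
  fromQ-toQ ((j , p) , j<K , w , inj₂ r) with suc j ℕ.≤? suc k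
  ... | yes _   = LowHalves-≡ refl
  ... | no j≰k = contradiction j<K j≰k
  fromQ-toQ ((j , p) , j<K , w , inj₁ r) with ℕP.m<1+n⇒m<n∨m≡n j<K | upView p
  ... | inj₂ refl | _          = LowHalves-≡ refl
  ... | inj₁ j<k  | notUp _    = LowHalves-≡ (cong (_, p) (FP.toℕ-fromℕ< j<k))
  ... | inj₁ j<k  | startsUp q with suc (j + suc k) ℕ.≤? suc k
  ...   | yes l≤K = contradiction l≤K (ℕP.m+n≮n j (suc k))
  ...   | no l≰K  = LowHalves-≡ (trans (fromLong-half q _ _ L) (cong (_, up ∷ q) (long-offset L)))
    where
    L = long l≰K (long-bound j<k)

  LowHalves↔Q : LowHalves m (suc k) ↔ Q m (suc k)
  LowHalves↔Q = mk↔ₛ′ toQ fromQ toQ-fromQ fromQ-toQ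

-- Theorem 2.20.
theorem2p20 : (m k : ℕ) → 1 ≤ m → 1 ≤ k → Q m k ⤖ SD (2 * m) k
theorem2p20 m zero    _ ()
theorem2p20 m (suc k) _ _ = ↔⇒⤖ (↔-sym SD↔Q)
  where
  SD↔Q : SD (2 * m) (suc k) ↔ Q m (suc k)
  SD↔Q = ↔-trans SD↔Halves (↔-trans Halves↔LowHalves LowHalves↔Q)
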